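{- Let $(x_n)$ be defined by $x_n=2x_{n-1}+2x_{n-2}+x_{n-3}$ with $x_0=0$, $x_1=1$, $x_2=2$. The only solutions of the equation $x_n=m!$ in positive integers $n,m$ are $(n,m)\in\{(1,1),(2,2),(3,3)\}$. -}

module Defs where

open import Data.Nat using (ℕ; zero; suc; _+_; _*_)

x : ℕ → ℕ
x 0 = 0
x 1 = 1
x 2 = 2
x (suc (suc (suc n))) = 2 * x (suc (suc n)) + 2 * x (suc n) + x n

-- Let θ be the root of θ³ = 2θ² + 2θ + 1, so that x n is the θ²-coefficient of θ^(n+1) in
-- ℕ[θ] = ℕ + ℕθ + ℕθ².  Since θ⁶ = 1 + 8θ⁴, lifting the exponent gives, for odd q,
-- θ^(6·2^i·q) = 1 + 2^(3+i)·(qθ⁴ + 4s); reading off coefficients, x (6·2^i·q) = 2^(3+i)·odd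
-- and x (6·2^i·q − 1) = 2^(4+i)·odd, while 4 ∤ x n for the other residues of n mod 6.
-- Hence 2^(4+j) ∣ x n forces n + 1 ≥ 6·2^j.  As 2^⌊m/2⌋ ∣ m! and x n ≥ 2^(n−1), a solution
-- with m ≥ 14 would give 2^(6·2^(⌊m/2⌋−4)) ≤ 4·m!, which is false; for m ≤ 13 we get n ≤ 33,
-- and these finitely many cases are checked by evaluation.
module Submission where

open import Algebra.Bundles.Raw using (RawSemiring)
open import Level using (0ℓ)

-- ⟨ a , b , c ⟩ stands for a + bθ + cθ².  The coefficients range over an arbitrary raw semiring
-- so that identities in ℕ[θ] can be checked on the ring solver's syntax.
module Cubic (R : RawSemiring 0ℓ 0ℓ) where
  open RawSemiring R
  open import Algebra.Definitions.RawSemiring R using (_×_)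

  infixl 6 _⊕_
  infixr 7 _·_
  infixl 8 _⊗_

  record R[θ] : Set where
    constructor ⟨_,_,_⟩
    field
      c₀ c₁ c₂ : Carrier

  open R[θ] public

  𝟙 θ : R[θ]
  𝟙 = ⟨ 1# , 0# , 0# ⟩
  θ = ⟨ 0# , 1# , 0# ⟩

  _⊕_ : R[θ] → R[θ] → R[θ]
  ⟨ a , b , c ⟩ ⊕ ⟨ a′ , b′ , c′ ⟩ = ⟨ a + a′ , b + b′ , c + c′ ⟩

  _·_ : Carrier → R[θ] → R[θ]
  k · ⟨ a , b , c ⟩ = ⟨ k * a , k * b , k * c ⟩

  -- u and v are the θ³- and θ⁴-coefficients of the plain product, reduced by
  -- θ³ = 1 + 2θ + 2θ² and θ⁴ = 2 + 5θ + 6θ².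
  _⊗_ : R[θ] → R[θ] → R[θ]
  ⟨ a , b , c ⟩ ⊗ ⟨ a′ , b′ , c′ ⟩ =
    ⟨ a * a′ + u + 2 × v
    , a * b′ + b * a′ + 2 × u + 5 × v
    , a * c′ + b * b′ + c * a′ + 2 × u + 6 × v
    ⟩
    where
    u = b * c′ + c * b′
    v = c * c′

open import Defs
open import Data.Nat using (ℕ; _≥_; _!)
open import Data.Product using (_×_; _,_)
open import Data.Sum using (_⊎_)
open import Function.Bundles using (_⇔_)
open import Relation.Binary.PropositionalEquality using (_≡_)

open import Algebra.Bundles using (Monoid)
import Algebra.Properties.Monoid.Mult as MonoidMult
open import Data.Empty using (⊥-elim)
open import Data.Nat.Base
  using (zero; suc; _+_; _*_; _^_; _≤_; _<_; z≤n; s≤s; ⌊_/2⌋; +-*-rawSemiring)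
open import Data.Nat.Divisibility
  using ( _∣_; divides; _∣?_; ∣-refl; ∣-trans; m∣m*n; ∣m⇒∣m*n; ∣n⇒∣m*n; ∣m∣n⇒∣m+n; ∣m+n∣m⇒∣n
        ; *-pres-∣; *-cancelˡ-∣)
open import Data.Nat.Induction using (<-rec)
open import Data.Nat.Properties
open import Data.Nat.Tactic.RingSolver using (ring; solve-∀)
open import Data.Product using (∃; ∃₂)
import Data.Sum as Sum
open import Data.Sum using (inj₁; inj₂)
open import Data.Vec.Base using (Vec; []; _∷_)
open import Data.Vec.N-ary using (N-ary)
open import Function.Bundles using (mk⇔)
open import Relation.Binary.PropositionalEquality
  using (_≢_; refl; cong; cong₂; sym; trans; subst; module ≡-Reasoning)
open import Relation.Binary.PropositionalEquality.Algebra using (isMagma)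
open import Relation.Nullary using (¬_; Dec; yes; no; contradiction)
open import Relation.Nullary.Decidable using (from-yes; from-no; _→-dec_; _×-dec_; _⊎-dec_)
import Tactic.RingSolver.NonReflective

open Cubic +-*-rawSemiring renaming (R[θ] to ℕ[θ])

module Solver = Tactic.RingSolver.NonReflective ring
open Solver using (Expr; Κ; solve; _⊜_) renaming (_⊕_ to _:+_; _⊗_ to _:*_)
open Solver.Ops using (⟦_⟧; ⟦_⇓⟧; close; prove)

Expr-rawSemiring : ℕ → RawSemiring 0ℓ 0ℓ
Expr-rawSemiring n = record
  { Carrier = Expr ℕ n ; _≈_ = _≡_ ; _+_ = _:+_ ; _*_ = _:*_ ; 0# = Κ 0 ; 1# = Κ 1 }

module E {n} = Cubic (Expr-rawSemiring n)

≡-componentwise : ∀ {p q : ℕ[θ]} → c₀ p ≡ c₀ q → c₁ p ≡ c₁ q → c₂ p ≡ c₂ q → p ≡ q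
≡-componentwise {⟨ _ , _ , _ ⟩} {⟨ _ , _ , _ ⟩} refl refl refl = refl

⟦_⟧θ ⟦_⇓⟧θ : ∀ {n} → E.R[θ] {n} → Vec ℕ n → ℕ[θ]
⟦ p ⟧θ  ρ = ⟨ ⟦ E.c₀ p ⟧ ρ , ⟦ E.c₁ p ⟧ ρ , ⟦ E.c₂ p ⟧ ρ ⟩
⟦ p ⇓⟧θ ρ = ⟨ ⟦ E.c₀ p ⇓⟧ ρ , ⟦ E.c₁ p ⇓⟧ ρ , ⟦ E.c₂ p ⇓⟧ ρ ⟩

solve-ℕ[θ] : ∀ n (f : N-ary n (Expr ℕ n) (E.R[θ] × E.R[θ])) (ρ : Vec ℕ n) →
             let l , r = close n f in ⟦ l ⇓⟧θ ρ ≡ ⟦ r ⇓⟧θ ρ → ⟦ l ⟧θ ρ ≡ ⟦ r ⟧θ ρ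
solve-ℕ[θ] n f ρ l⇓≡r⇓ = let l , r = close n f in ≡-componentwise
  (prove ρ (E.c₀ l) (E.c₀ r) (cong c₀ l⇓≡r⇓))
  (prove ρ (E.c₁ l) (E.c₁ r) (cong c₁ l⇓≡r⇓))
  (prove ρ (E.c₂ l) (E.c₂ r) (cong c₂ l⇓≡r⇓))

⊗-assoc : ∀ p q r → (p ⊗ q) ⊗ r ≡ p ⊗ (q ⊗ r)
⊗-assoc ⟨ a , b , c ⟩ ⟨ d , e , f ⟩ ⟨ g , h , i ⟩ = solve-ℕ[θ] 9
  (λ a b c d e f g h i → let p = E.⟨ a , b , c ⟩; q = E.⟨ d , e , f ⟩; r = E.⟨ g , h , i ⟩ in
    (p E.⊗ q) E.⊗ r , p E.⊗ (q E.⊗ r))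
  (a ∷ b ∷ c ∷ d ∷ e ∷ f ∷ g ∷ h ∷ i ∷ []) refl

⊗-identityˡ : ∀ p → 𝟙 ⊗ p ≡ p
⊗-identityˡ ⟨ a , b , c ⟩ =
  solve-ℕ[θ] 3 (λ a b c → E.𝟙 E.⊗ E.⟨ a , b , c ⟩ , E.⟨ a , b , c ⟩) (a ∷ b ∷ c ∷ []) refl

⊗-identityʳ : ∀ p → p ⊗ 𝟙 ≡ p
⊗-identityʳ ⟨ a , b , c ⟩ =
  solve-ℕ[θ] 3 (λ a b c → E.⟨ a , b , c ⟩ E.⊗ E.𝟙 , E.⟨ a , b , c ⟩) (a ∷ b ∷ c ∷ []) refl

⊗-monoid : Monoid 0ℓ 0ℓ
⊗-monoid = record
  { isMonoid = record
    { isSemigroup = record { isMagma = isMagma _⊗_ ; assoc = ⊗-assoc }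
    ; identity    = ⊗-identityˡ , ⊗-identityʳ
    }
  }

module Power = MonoidMult ⊗-monoid

infix 9 _⊗^_

_⊗^_ : ℕ[θ] → ℕ → ℕ[θ]
p ⊗^ n = n Power.× p

θ³-relation : ∀ p → θ ⊗ (θ ⊗ (θ ⊗ p)) ≡ 2 · (θ ⊗ (θ ⊗ p)) ⊕ 2 · (θ ⊗ p) ⊕ p
θ³-relation ⟨ a , b , c ⟩ = solve-ℕ[θ] 3
  (λ a b c → let p = E.⟨ a , b , c ⟩ in
    E.θ E.⊗ (E.θ E.⊗ (E.θ E.⊗ p)) , Κ 2 E.· (E.θ E.⊗ (E.θ E.⊗ p)) E.⊕ Κ 2 E.· (E.θ E.⊗ p) E.⊕ p)
  (a ∷ b ∷ c ∷ []) refl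

x≡c₂[θ^1+n] : ∀ n → x n ≡ c₂ (θ ⊗^ suc n)
x≡c₂[θ^1+n] 0 = refl
x≡c₂[θ^1+n] 1 = refl
x≡c₂[θ^1+n] 2 = refl
x≡c₂[θ^1+n] (suc (suc (suc n))) = begin
  2 * x (2 + n) + 2 * x (1 + n) + x n
    ≡⟨ cong₂ _+_ (cong₂ _+_ (cong (2 *_) (x≡c₂[θ^1+n] (suc (suc n))))
                            (cong (2 *_) (x≡c₂[θ^1+n] (suc n))))
                 (x≡c₂[θ^1+n] n) ⟩
  2 * c₂ (θ ⊗^ (3 + n)) + 2 * c₂ (θ ⊗^ (2 + n)) + c₂ (θ ⊗^ (1 + n))
    ≡⟨ cong c₂ (θ³-relation (θ ⊗^ suc n)) ⟨
  c₂ (θ ⊗^ (4 + n)) ∎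
  where open ≡-Reasoning

c₂[θ⊗p] : ∀ p → c₂ (θ ⊗ p) ≡ c₁ p + 2 * c₂ p
c₂[θ⊗p] ⟨ a , b , c ⟩ =
  solve 3 (λ a b c → E.c₂ (E.θ E.⊗ E.⟨ a , b , c ⟩) ⊜ (b :+ Κ 2 :* c)) refl a b c

x≡c₁+2c₂[θ^n] : ∀ n → x n ≡ c₁ (θ ⊗^ n) + 2 * c₂ (θ ⊗^ n)
x≡c₁+2c₂[θ^n] n = trans (x≡c₂[θ^1+n] n) (c₂[θ⊗p] (θ ⊗^ n))

p⊗[𝟙⊕k·q] : ∀ k q p → p ⊗ (𝟙 ⊕ k · q) ≡ k · (p ⊗ q) ⊕ p
p⊗[𝟙⊕k·q] k ⟨ a , b , c ⟩ ⟨ d , e , f ⟩ = solve-ℕ[θ] 7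
  (λ k a b c d e f → let q = E.⟨ a , b , c ⟩; p = E.⟨ d , e , f ⟩ in
    p E.⊗ (E.𝟙 E.⊕ k E.· q) , k E.· (p E.⊗ q) E.⊕ p)
  (k ∷ a ∷ b ∷ c ∷ d ∷ e ∷ f ∷ []) refl

x[6+n]≡8x[4+n]+x[n] : ∀ n → x (6 + n) ≡ 8 * x (4 + n) + x n
x[6+n]≡8x[4+n]+x[n] n = begin
  x (6 + n)                                        ≡⟨ cong x (+-comm 6 n) ⟩
  x (n + 6)                                        ≡⟨ x≡c₂[θ^1+n] (n + 6) ⟩
  c₂ (θ ⊗^ (suc n + 6))                            ≡⟨ cong c₂ (Power.×-homo-+ θ (suc n) 6) ⟩
  c₂ (θ ⊗^ suc n ⊗ θ ⊗^ 6)                         ≡⟨⟩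
  c₂ (θ ⊗^ suc n ⊗ (𝟙 ⊕ 8 · θ ⊗^ 4))
    ≡⟨ cong c₂ (p⊗[𝟙⊕k·q] 8 (θ ⊗^ 4) (θ ⊗^ suc n)) ⟩
  8 * c₂ (θ ⊗^ suc n ⊗ θ ⊗^ 4) + c₂ (θ ⊗^ suc n)
    ≡⟨ cong (λ p → 8 * c₂ p + c₂ (θ ⊗^ suc n)) (Power.×-homo-+ θ (suc n) 4) ⟨
  8 * c₂ (θ ⊗^ (suc n + 4)) + c₂ (θ ⊗^ suc n)
    ≡⟨ cong₂ (λ a b → 8 * a + b) (x≡c₂[θ^1+n] (n + 4)) (x≡c₂[θ^1+n] n) ⟨
  8 * x (n + 4) + x n                              ≡⟨ cong (λ k → 8 * x k + x n) (+-comm n 4) ⟩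
  8 * x (4 + n) + x n                              ∎
  where open ≡-Reasoning

4∣x[n]⇒6∣n⊎6∣1+n : ∀ n → 4 ∣ x n → 6 ∣ n ⊎ 6 ∣ suc n
4∣x[n]⇒6∣n⊎6∣1+n 0 _   = inj₁ (divides 0 refl)
4∣x[n]⇒6∣n⊎6∣1+n 1 4∣x = contradiction 4∣x (from-no (4 ∣? x 1))
4∣x[n]⇒6∣n⊎6∣1+n 2 4∣x = contradiction 4∣x (from-no (4 ∣? x 2))
4∣x[n]⇒6∣n⊎6∣1+n 3 4∣x = contradiction 4∣x (from-no (4 ∣? x 3))
4∣x[n]⇒6∣n⊎6∣1+n 4 4∣x = contradiction 4∣x (from-no (4 ∣? x 4))
4∣x[n]⇒6∣n⊎6∣1+n 5 _   = inj₂ (divides 1 refl)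
4∣x[n]⇒6∣n⊎6∣1+n (suc (suc (suc (suc (suc (suc n)))))) 4∣x =
  Sum.map (∣m∣n⇒∣m+n ∣-refl) (∣m∣n⇒∣m+n ∣-refl) (4∣x[n]⇒6∣n⊎6∣1+n n 4∣x[n])
  where
  4∣x[n] : 4 ∣ x n
  4∣x[n] = ∣m+n∣m⇒∣n (subst (4 ∣_) (x[6+n]≡8x[4+n]+x[n] n) 4∣x)
                      (∣m⇒∣m*n (x (4 + n)) (divides 2 refl))

·-assoc : ∀ m n p → (m * n) · p ≡ m · n · p
·-assoc m n ⟨ a , b , c ⟩ = ≡-componentwise (*-assoc m n a) (*-assoc m n b) (*-assoc m n c)

[𝟙⊕M·y]^q : ∀ M y q → ∃ λ s → (𝟙 ⊕ M · y) ⊗^ q ≡ 𝟙 ⊕ M · (q · y ⊕ M · s)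
[𝟙⊕M·y]^q M y zero = ⟨ 0 , 0 , 0 ⟩ , base y
  where
  base : ∀ y → 𝟙 ≡ 𝟙 ⊕ M · (0 · y ⊕ M · ⟨ 0 , 0 , 0 ⟩)
  base ⟨ a , b , c ⟩ = solve-ℕ[θ] 4
    (λ M a b c → E.𝟙 ,
                 E.𝟙 E.⊕ M E.· (Κ 0 E.· E.⟨ a , b , c ⟩ E.⊕ M E.· E.⟨ Κ 0 , Κ 0 , Κ 0 ⟩))
    (M ∷ a ∷ b ∷ c ∷ []) refl
[𝟙⊕M·y]^q M y (suc q) with [𝟙⊕M·y]^q M y q
... | s , eq = s ⊕ y ⊗ (q · y ⊕ M · s) , trans (cong ((𝟙 ⊕ M · y) ⊗_) eq) (step y s)
  where
  step : ∀ y s → (𝟙 ⊕ M · y) ⊗ (𝟙 ⊕ M · (q · y ⊕ M · s))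
                 ≡ 𝟙 ⊕ M · (suc q · y ⊕ M · (s ⊕ y ⊗ (q · y ⊕ M · s)))
  step ⟨ a , b , c ⟩ ⟨ d , e , f ⟩ = solve-ℕ[θ] 8
    (λ M q a b c d e f → let y = E.⟨ a , b , c ⟩; s = E.⟨ d , e , f ⟩; z = q E.· y E.⊕ M E.· s in
      (E.𝟙 E.⊕ M E.· y) E.⊗ (E.𝟙 E.⊕ M E.· z) ,
      E.𝟙 E.⊕ M E.· ((Κ 1 :+ q) E.· y E.⊕ M E.· (s E.⊕ y E.⊗ z)))
    (M ∷ q ∷ a ∷ b ∷ c ∷ d ∷ e ∷ f ∷ []) refl

[𝟙⊕8K·[y⊕4s]]² : ∀ K y s → let z = y ⊕ 4 · s in
  (𝟙 ⊕ (8 * K) · z) ⊗ (𝟙 ⊕ (8 * K) · z) ≡ 𝟙 ⊕ (8 * (2 * K)) · (y ⊕ 4 · (s ⊕ K · (z ⊗ z)))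
[𝟙⊕8K·[y⊕4s]]² K ⟨ a , b , c ⟩ ⟨ d , e , f ⟩ = solve-ℕ[θ] 7
  (λ K a b c d e f → let y = E.⟨ a , b , c ⟩; s = E.⟨ d , e , f ⟩; z = y E.⊕ Κ 4 E.· s in
    (E.𝟙 E.⊕ (Κ 8 :* K) E.· z) E.⊗ (E.𝟙 E.⊕ (Κ 8 :* K) E.· z) ,
    E.𝟙 E.⊕ (Κ 8 :* (Κ 2 :* K)) E.· (y E.⊕ Κ 4 E.· (s E.⊕ K E.· (z E.⊗ z))))
  (K ∷ a ∷ b ∷ c ∷ d ∷ e ∷ f ∷ []) refl

θ^[2^i*q*6] : ∀ i q → ∃ λ s → θ ⊗^ (2 ^ i * q * 6) ≡ 𝟙 ⊕ (8 * 2 ^ i) · (q · θ ⊗^ 4 ⊕ 4 · s)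
θ^[2^i*q*6] zero q with [𝟙⊕M·y]^q 8 (θ ⊗^ 4) q
... | s , eq = 2 · s , (begin
  θ ⊗^ (1 * q * 6)                 ≡⟨ cong (λ k → θ ⊗^ (k * 6)) (*-identityˡ q) ⟩
  θ ⊗^ (q * 6)                     ≡⟨ Power.×-assocˡ θ q 6 ⟨
  (θ ⊗^ 6) ⊗^ q                    ≡⟨⟩
  (𝟙 ⊕ 8 · θ ⊗^ 4) ⊗^ q            ≡⟨ eq ⟩
  𝟙 ⊕ 8 · (q · θ ⊗^ 4 ⊕ 8 · s)     ≡⟨ cong (λ p → 𝟙 ⊕ 8 · (q · θ ⊗^ 4 ⊕ p)) (·-assoc 4 2 s) ⟩
  𝟙 ⊕ 8 · (q · θ ⊗^ 4 ⊕ 4 · 2 · s) ∎)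
  where open ≡-Reasoning
θ^[2^i*q*6] (suc i) q with θ^[2^i*q*6] i q
... | s , eq = s ⊕ 2 ^ i · (z ⊗ z) , (begin
  θ ⊗^ (2 ^ suc i * q * 6)                      ≡⟨ cong (θ ⊗^_) (double (2 ^ i) q) ⟩
  θ ⊗^ (k + k)                                  ≡⟨ Power.×-homo-+ θ k k ⟩
  θ ⊗^ k ⊗ θ ⊗^ k                               ≡⟨ cong₂ _⊗_ eq eq ⟩
  (𝟙 ⊕ (8 * 2 ^ i) · z) ⊗ (𝟙 ⊕ (8 * 2 ^ i) · z)
    ≡⟨ [𝟙⊕8K·[y⊕4s]]² (2 ^ i) (q · θ ⊗^ 4) s ⟩
  𝟙 ⊕ (8 * 2 ^ suc i) · (q · θ ⊗^ 4 ⊕ 4 · (s ⊕ 2 ^ i · (z ⊗ z))) ∎)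
  where
  open ≡-Reasoning
  k = 2 ^ i * q * 6
  z = q · θ ⊗^ 4 ⊕ 4 · s
  double : ∀ K q → 2 * K * q * 6 ≡ K * q * 6 + K * q * 6
  double = solve-∀

x[2^i*odd*6] : ∀ i q → ∃ λ z → x (2 ^ i * suc (2 * q) * 6) ≡ 2 ^ (3 + i) * suc (2 * z)
x[2^i*odd*6] i q with θ^[2^i*q*6] i (suc (2 * q))
... | s , eq = z , (begin
  x k                              ≡⟨ x≡c₁+2c₂[θ^n] k ⟩
  c₁ (θ ⊗^ k) + 2 * c₂ (θ ⊗^ k)    ≡⟨ cong (λ p → c₁ p + 2 * c₂ p) eq ⟩
  M * c₁ y + 2 * (M * c₂ y)        ≡⟨ factor M (c₁ y) (c₂ y) ⟩
  M * (c₁ y + 2 * c₂ y)            ≡⟨ cong (M *_) (odd q (c₁ s) (c₂ s)) ⟩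
  M * suc (2 * z)                  ≡⟨ cong (_* suc (2 * z)) (^-distribˡ-+-* 2 3 i) ⟨
  2 ^ (3 + i) * suc (2 * z)        ∎)
  where
  open ≡-Reasoning
  k = 2 ^ i * suc (2 * q) * 6
  M = 8 * 2 ^ i
  y = suc (2 * q) · θ ⊗^ 4 ⊕ 4 · s
  z = 8 + 17 * q + 2 * (c₁ s + 2 * c₂ s)
  factor : ∀ M a b → M * a + 2 * (M * b) ≡ M * (a + 2 * b)
  factor = solve-∀
  odd : ∀ q a b → suc (2 * q) * 5 + 4 * a + 2 * (suc (2 * q) * 6 + 4 * b)
                  ≡ suc (2 * (8 + 17 * q + 2 * (a + 2 * b)))
  odd = solve-∀

x[2^i*odd*6∸1] : ∀ i q n → suc n ≡ 2 ^ i * suc (2 * q) * 6 →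
                 ∃ λ z → x n ≡ 2 ^ (4 + i) * suc (2 * z)
x[2^i*odd*6∸1] i q n 1+n≡k with θ^[2^i*q*6] i (suc (2 * q))
... | s , eq = z , (begin
  x n                                 ≡⟨ x≡c₂[θ^1+n] n ⟩
  c₂ (θ ⊗^ suc n)                     ≡⟨ cong (λ m → c₂ (θ ⊗^ m)) 1+n≡k ⟩
  c₂ (θ ⊗^ (2 ^ i * suc (2 * q) * 6)) ≡⟨ cong c₂ eq ⟩
  M * (suc (2 * q) * 6 + 4 * c₂ s)    ≡⟨ regroup M q (c₂ s) ⟩
  2 * M * suc (2 * z)                 ≡⟨ cong (λ m → 2 * m * suc (2 * z)) (^-distribˡ-+-* 2 3 i) ⟨
  2 ^ (4 + i) * suc (2 * z)           ∎)
  where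
  open ≡-Reasoning
  M = 8 * 2 ^ i
  z = 1 + 3 * q + c₂ s
  regroup : ∀ M q b → M * (suc (2 * q) * 6 + 4 * b) ≡ 2 * M * suc (2 * (1 + 3 * q + b))
  regroup = solve-∀

even⊎odd : ∀ k → ∃ λ h → k ≡ 2 * h ⊎ k ≡ suc (2 * h)
even⊎odd zero = 0 , inj₁ refl
even⊎odd (suc k) with even⊎odd k
... | h , inj₁ k≡2h   = h , inj₂ (cong suc k≡2h)
... | h , inj₂ k≡1+2h = suc h , inj₁ (trans (cong suc k≡1+2h) (sym (*-suc 2 h)))

1+k≡2^i*odd : ∀ k → ∃₂ λ i q → suc k ≡ 2 ^ i * suc (2 * q)
1+k≡2^i*odd = <-rec _ split
  where
  split : ∀ k → (∀ {h} → h < k → ∃₂ λ i q → suc h ≡ 2 ^ i * suc (2 * q)) →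
          ∃₂ λ i q → suc k ≡ 2 ^ i * suc (2 * q)
  split k rec with even⊎odd k
  ... | h , inj₁ refl = 0 , h , sym (*-identityˡ (suc (2 * h)))
  ... | h , inj₂ refl with rec (s≤s (m≤m+n h (h + 0)))
  ...   | i , q , 1+h≡2^i*odd = suc i , q , (begin
    2 + 2 * h                 ≡⟨ *-suc 2 h ⟨
    2 * suc h                 ≡⟨ cong (2 *_) 1+h≡2^i*odd ⟩
    2 * (2 ^ i * suc (2 * q)) ≡⟨ *-assoc 2 (2 ^ i) (suc (2 * q)) ⟨
    2 ^ suc i * suc (2 * q)   ∎)
    where open ≡-Reasoning

6∣1+m⇒1+m≡2^i*odd*6 : ∀ {m} → 6 ∣ suc m → ∃₂ λ i q → suc m ≡ 2 ^ i * suc (2 * q) * 6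
6∣1+m⇒1+m≡2^i*odd*6 (divides (suc k) 1+m≡[1+k]*6) with 1+k≡2^i*odd k
... | i , q , 1+k≡2^i*odd = i , q , trans 1+m≡[1+k]*6 (cong (_* 6) 1+k≡2^i*odd)

2∤1+2z : ∀ z → ¬ 2 ∣ suc (2 * z)
2∤1+2z z (divides q 1+2z≡q*2) = even≢odd q z (trans (*-comm 2 q) (sym 1+2z≡q*2))

2^a∣2^b*odd⇒a≤b : ∀ a b z → 2 ^ a ∣ 2 ^ b * suc (2 * z) → a ≤ b
2^a∣2^b*odd⇒a≤b zero    b       _ _ = z≤n
2^a∣2^b*odd⇒a≤b (suc a) zero    z 2^[1+a]∣odd = contradiction
  (∣-trans (m∣m*n (2 ^ a)) (subst (2 ^ suc a ∣_) (*-identityˡ (suc (2 * z))) 2^[1+a]∣odd)) (2∤1+2z z)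
2^a∣2^b*odd⇒a≤b (suc a) (suc b) z 2^[1+a]∣2^[1+b]*odd = s≤s (2^a∣2^b*odd⇒a≤b a b z
  (*-cancelˡ-∣ 2 (subst (2 ^ suc a ∣_) (*-assoc 2 (2 ^ b) (suc (2 * z))) 2^[1+a]∣2^[1+b]*odd)))

2^a∣2^[a+b] : ∀ a b → 2 ^ a ∣ 2 ^ (a + b)
2^a∣2^[a+b] a b = subst (2 ^ a ∣_) (sym (^-distribˡ-+-* 2 a b)) (m∣m*n (2 ^ b))

6*2^j≤2^i*odd*6 : ∀ {i j} q → j ≤ i → 6 * 2 ^ j ≤ 2 ^ i * suc q * 6
6*2^j≤2^i*odd*6 {i} {j} q j≤i = begin
  6 * 2 ^ j           ≤⟨ *-monoʳ-≤ 6 (≤-trans (^-monoʳ-≤ 2 j≤i) (m≤m*n (2 ^ i) (suc q))) ⟩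
  6 * (2 ^ i * suc q) ≡⟨ *-comm 6 (2 ^ i * suc q) ⟩
  2 ^ i * suc q * 6   ∎
  where open ≤-Reasoning

2^[4+j]∣x[2^i*odd*6]⇒ : ∀ j i q {m} → m ≡ 2 ^ i * suc (2 * q) * 6 →
                        2 ^ (4 + j) ∣ x m → 6 * 2 ^ j ≤ m
2^[4+j]∣x[2^i*odd*6]⇒ j i q m≡k 2^[4+j]∣x =
  let z , x≡2^[3+i]*odd = x[2^i*odd*6] i q
      4+j≤3+i = 2^a∣2^b*odd⇒a≤b (4 + j) (3 + i) z
                  (subst (2 ^ (4 + j) ∣_) (trans (cong x m≡k) x≡2^[3+i]*odd) 2^[4+j]∣x)
  in subst (6 * 2 ^ j ≤_) (sym m≡k) (6*2^j≤2^i*odd*6 (2 * q) (<⇒≤ (+-cancelˡ-≤ 3 (suc j) i 4+j≤3+i)))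

2^[4+j]∣x[2^i*odd*6∸1]⇒ : ∀ j i q {n} → suc n ≡ 2 ^ i * suc (2 * q) * 6 →
                          2 ^ (4 + j) ∣ x n → 6 * 2 ^ j ≤ suc n
2^[4+j]∣x[2^i*odd*6∸1]⇒ j i q {n} 1+n≡k 2^[4+j]∣x =
  let z , x≡2^[4+i]*odd = x[2^i*odd*6∸1] i q n 1+n≡k
      4+j≤4+i = 2^a∣2^b*odd⇒a≤b (4 + j) (4 + i) z (subst (2 ^ (4 + j) ∣_) x≡2^[4+i]*odd 2^[4+j]∣x)
  in subst (6 * 2 ^ j ≤_) (sym 1+n≡k) (6*2^j≤2^i*odd*6 (2 * q) (+-cancelˡ-≤ 4 j i 4+j≤4+i))

2^[4+j]∣x[1+n]⇒6*2^j≤2+n : ∀ j n → 2 ^ (4 + j) ∣ x (suc n) → 6 * 2 ^ j ≤ 2 + n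
2^[4+j]∣x[1+n]⇒6*2^j≤2+n j n 2^[4+j]∣x
  with 4∣x[n]⇒6∣n⊎6∣1+n (suc n) (∣-trans (2^a∣2^[a+b] 2 (2 + j)) 2^[4+j]∣x)
... | inj₁ 6∣1+n = let i , q , 1+n≡k = 6∣1+m⇒1+m≡2^i*odd*6 6∣1+n in
  ≤-trans (2^[4+j]∣x[2^i*odd*6]⇒ j i q 1+n≡k 2^[4+j]∣x) (n≤1+n (suc n))
... | inj₂ 6∣2+n = let i , q , 2+n≡k = 6∣1+m⇒1+m≡2^i*odd*6 6∣2+n in
  2^[4+j]∣x[2^i*odd*6∸1]⇒ j i q 2+n≡k 2^[4+j]∣x

2^n≤x[1+n] : ∀ n → 2 ^ n ≤ x (suc n)
2^n≤x[1+n] 0 = ≤-refl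
2^n≤x[1+n] 1 = ≤-refl
2^n≤x[1+n] (suc (suc n)) = begin
  2 * 2 ^ suc n                         ≤⟨ *-monoʳ-≤ 2 (2^n≤x[1+n] (suc n)) ⟩
  2 * x (2 + n)                         ≤⟨ m≤m+n _ _ ⟩
  2 * x (2 + n) + 2 * x (1 + n)         ≤⟨ m≤m+n _ _ ⟩
  2 * x (2 + n) + 2 * x (1 + n) + x n   ∎
  where open ≤-Reasoning

2∣[2+n]*[1+n] : ∀ n → 2 ∣ (2 + n) * (1 + n)
2∣[2+n]*[1+n] n with even⊎odd n
... | h , inj₁ refl = ∣m⇒∣m*n (1 + 2 * h) (subst (2 ∣_) (*-suc 2 h) (m∣m*n (suc h)))
... | h , inj₂ refl = ∣n⇒∣m*n (3 + 2 * h) (subst (2 ∣_) (*-suc 2 h) (m∣m*n (suc h)))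

2^⌊n/2⌋∣n! : ∀ n → 2 ^ ⌊ n /2⌋ ∣ n !
2^⌊n/2⌋∣n! 0 = ∣-refl
2^⌊n/2⌋∣n! 1 = ∣-refl
2^⌊n/2⌋∣n! (suc (suc n)) =
  subst (2 * 2 ^ ⌊ n /2⌋ ∣_) (*-assoc (2 + n) (1 + n) (n !)) (*-pres-∣ (2∣[2+n]*[1+n] n) (2^⌊n/2⌋∣n! n))

[16+r]*[15+r]≤4*[14+r]! : ∀ r → (16 + r) * (15 + r) ≤ 4 * (14 + r) !
[16+r]*[15+r]≤4*[14+r]! r = begin
  (16 + r) * (15 + r)                                ≤⟨ m≤m+n _ _ ⟩
  (16 + r) * (15 + r) + (488 + 77 * r + 3 * (r * r)) ≡⟨ expand r ⟩
  4 * ((14 + r) * (13 + r))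
    ≤⟨ *-monoʳ-≤ 4 (*-monoʳ-≤ (14 + r) (m≤m*n (13 + r) ((12 + r) !) {{(12 + r) !≢0}})) ⟩
  4 * (14 + r) !                                     ∎
  where
  open ≤-Reasoning
  expand : ∀ r → (16 + r) * (15 + r) + (488 + 77 * r + 3 * (r * r)) ≡ 4 * ((14 + r) * (13 + r))
  expand = solve-∀

4*[14+r]!<2^[6*2^[3+⌊r/2⌋]] : ∀ r → 4 * (14 + r) ! < 2 ^ (6 * 2 ^ (3 + ⌊ r /2⌋))
4*[14+r]!<2^[6*2^[3+⌊r/2⌋]] 0 = from-yes (4 * 14 ! <? 2 ^ 48)
4*[14+r]!<2^[6*2^[3+⌊r/2⌋]] 1 = from-yes (4 * 15 ! <? 2 ^ 48)
4*[14+r]!<2^[6*2^[3+⌊r/2⌋]] (suc (suc r)) = begin-strict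
  4 * (16 + r) !                           ≡⟨ regroup (16 + r) (15 + r) ((14 + r) !) ⟩
  (16 + r) * (15 + r) * (4 * (14 + r) !)   ≤⟨ *-monoˡ-≤ (4 * (14 + r) !) ([16+r]*[15+r]≤4*[14+r]! r) ⟩
  4 * (14 + r) ! * (4 * (14 + r) !)        <⟨ *-mono-< ih ih ⟩
  2 ^ e * 2 ^ e                            ≡⟨ ^-distribˡ-+-* 2 e e ⟨
  2 ^ (e + e)                              ≡⟨ cong (2 ^_) (double (2 ^ (3 + ⌊ r /2⌋))) ⟨
  2 ^ (6 * 2 ^ (3 + ⌊ 2 + r /2⌋))          ∎
  where
  open ≤-Reasoning
  e = 6 * 2 ^ (3 + ⌊ r /2⌋)
  ih = 4*[14+r]!<2^[6*2^[3+⌊r/2⌋]] r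
  regroup : ∀ a b c → 4 * (a * (b * c)) ≡ a * b * (4 * c)
  regroup = solve-∀
  double : ∀ a → 6 * (2 * a) ≡ 6 * a + 6 * a
  double = solve-∀

x[1+n]≢[14+r]! : ∀ n r → x (suc n) ≢ (14 + r) !
x[1+n]≢[14+r]! n r x≡[14+r]! = <⇒≱ (4*[14+r]!<2^[6*2^[3+⌊r/2⌋]] r) (begin
  2 ^ (6 * 2 ^ j)   ≤⟨ ^-monoʳ-≤ 2 (2^[4+j]∣x[1+n]⇒6*2^j≤2+n j n 2^[4+j]∣x) ⟩
  2 ^ (2 + n)       ≡⟨ ^-distribˡ-+-* 2 2 n ⟩
  4 * 2 ^ n         ≤⟨ *-monoʳ-≤ 4 (2^n≤x[1+n] n) ⟩
  4 * x (suc n)     ≡⟨ cong (4 *_) x≡[14+r]! ⟩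
  4 * (14 + r) !    ∎)
  where
  open ≤-Reasoning
  j = 3 + ⌊ r /2⌋
  2^[4+j]∣x : 2 ^ (4 + j) ∣ x (suc n)
  2^[4+j]∣x = subst (2 ^ (4 + j) ∣_) (sym x≡[14+r]!) (2^⌊n/2⌋∣n! (14 + r))

KnownSolution : ℕ → ℕ → Set
KnownSolution n m = (n ≡ 1 × m ≡ 1) ⊎ (n ≡ 2 × m ≡ 2) ⊎ (n ≡ 3 × m ≡ 3)

knownSolution? : ∀ n m → Dec (KnownSolution n m)
knownSolution? n m = (n ≟ 1 ×-dec m ≟ 1) ⊎-dec (n ≟ 2 ×-dec m ≟ 2) ⊎-dec (n ≟ 3 ×-dec m ≟ 3)

[1+b]!<2^33 : ∀ {b} → b < 13 → suc b ! < 2 ^ 33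
[1+b]!<2^33 = from-yes (allUpTo? (λ b → suc b ! <? 2 ^ 33) 13)

-- Evaluated through ℕ[θ], since unfolding x directly takes time exponential in n.
c₂θ^[2+n]≡[1+b]!⇒ : ∀ {n} → n < 33 → ∀ {b} → b < 13 →
                    c₂ (θ ⊗^ (2 + n)) ≡ suc b ! → KnownSolution (suc n) (suc b)
c₂θ^[2+n]≡[1+b]!⇒ = from-yes (allUpTo? (λ n → allUpTo? (λ b →
  c₂ (θ ⊗^ (2 + n)) ≟ suc b ! →-dec knownSolution? (suc n) (suc b)) 13) 33)

x[1+n]≡[1+b]!⇒ : ∀ n b → b < 13 → x (suc n) ≡ suc b ! → KnownSolution (suc n) (suc b)
x[1+n]≡[1+b]!⇒ n b b<13 x≡[1+b]! with n <? 33
... | yes n<33 = c₂θ^[2+n]≡[1+b]!⇒ n<33 b<13 (trans (sym (x≡c₂[θ^1+n] (suc n))) x≡[1+b]!)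
... | no n≮33 = ⊥-elim (<⇒≱ ([1+b]!<2^33 b<13) (begin
  2 ^ 33       ≤⟨ ^-monoʳ-≤ 2 (≮⇒≥ n≮33) ⟩
  2 ^ n        ≤⟨ 2^n≤x[1+n] n ⟩
  x (suc n)    ≡⟨ x≡[1+b]! ⟩
  suc b !      ∎))
  where open ≤-Reasoning

x[1+n]≡m!⇒ : ∀ n m → 1 ≤ m → x (suc n) ≡ m ! → KnownSolution (suc n) m
x[1+n]≡m!⇒ n (suc b) _ x≡m! with b <? 13
... | yes b<13 = x[1+n]≡[1+b]!⇒ n b b<13 x≡m!
... | no b≮13 = let r , 13+r≡b = m≤n⇒∃[o]m+o≡n (≮⇒≥ b≮13) in
  ⊥-elim (x[1+n]≢[14+r]! n r (subst (λ k → x (suc n) ≡ suc k !) (sym 13+r≡b) x≡m!))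

KnownSolution⇒x≡m! : ∀ {n m} → KnownSolution n m → x n ≡ m !
KnownSolution⇒x≡m! (inj₁ (refl , refl))        = refl
KnownSolution⇒x≡m! (inj₂ (inj₁ (refl , refl))) = refl
KnownSolution⇒x≡m! (inj₂ (inj₂ (refl , refl))) = refl

theorem1p11 : (n m : ℕ) → n ≥ 1 → m ≥ 1 →
    ((x n ≡ m !) ⇔ ((n ≡ 1 × m ≡ 1) ⊎ (n ≡ 2 × m ≡ 2) ⊎ (n ≡ 3 × m ≡ 3)))
theorem1p11 (suc n) m (s≤s z≤n) m≥1 = mk⇔ (x[1+n]≡m!⇒ n m m≥1) KnownSolution⇒x≡m!
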